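{- For every $n\in\{2,4,6,\ldots\}$, $$\sum_{\substack{1\le k\le n\\ 4\mid k}}\binom nk\big((-4)^{\frac k4}-2\big)B_{n-k}=\frac n2\Big((-1)^{\lfloor\frac n4\rfloor}2^{\frac n2-1}-1\Big).$$
   Context: The Bernoulli numbers $B_n$ are defined by $B_0=1$ and $\sum_{k=0}^{n-1}\binom nkB_k=0$ for $n\ge 2$. $\lfloor y\rfloor$ denotes the greatest integer not exceeding $y$. -}

module Defs where

open import Data.Nat as ℕ using (ℕ; zero; suc)
open import Data.Integer as ℤ using (ℤ)
open import Data.Rational using (ℚ; 0ℚ; 1ℚ; _+_; _*_; _/_)
open import Relation.Binary.PropositionalEquality using (_≡_)
open import Data.Product using (_×_)
open import Data.Nat.Combinatorics using (_C_)
open import Data.Nat.Divisibility using (_∣?_)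
open import Relation.Nullary.Decidable using (does)
open import Data.Bool using (if_then_else_)

_^ℚ_ : ℚ → ℕ → ℚ
q ^ℚ zero    = 1ℚ
q ^ℚ (suc n) = q * (q ^ℚ n)

Σ[_≤k≤_] : ℕ → ℕ → (ℕ → ℚ) → ℚ
Σ[ a ≤k≤ zero ] f = if does (a ℕ.≤? 0) then f 0 else 0ℚ
Σ[ a ≤k≤ suc b ] f = Σ[ a ≤k≤ b ] f + (if does (a ℕ.≤? suc b) then f (suc b) else 0ℚ)

sumDiv : ℕ → ℕ → ℕ → (ℕ → ℚ) → ℚ
sumDiv a b d f = Σ[ a ≤k≤ b ] (λ k → if does (d ∣? k) then f k else 0ℚ)

ℕ→ℚ : ℕ → ℚ
ℕ→ℚ n = (ℤ.+ n) / 1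

IsBernoulli : (ℕ → ℚ) → Set
IsBernoulli B =
  (B 0 ≡ 1ℚ) ×
  (∀ n → 2 ℕ.≤ n → Σ[ 0 ≤k≤ n ℕ.∸ 1 ] (λ k → ℕ→ℚ (n C k) * B k) ≡ 0ℚ)

-- For every sequence a, exchanging the order of summation and using the recurrence
-- Σ_{m<M} C(M,m) B_m = [M = 1] gives
--   Σ_{k≤n} C(n,k) (Σ_{j<k} C(k,j) a_j) B_{n-k} = n a_{n-1}.
-- So it suffices to find a with Σ_{j<k} C(k,j) a_j = [4 ∣ k]((-4)^{k/4} - 2) for k ≥ 1.
-- Take a_j = ½ Re(i^j + (-1)^j - (i-1)^j - 0^j): by the binomial theorem over ℚ(i),
-- Σ_{j≤k} C(k,j) w^j = (1+w)^k, and since i, -1, 1 have fourth power 1 while 1+i and i-1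
-- have fourth power -4, both the transform and a_{n-1} are read off from n mod 4.
{-# OPTIONS --safe #-}
module Submission where

open import Defs
open import Data.Nat as ℕ using (ℕ; _∸_)
open import Data.Nat.Divisibility using (_∣_)
open import Data.Nat.Combinatorics using (_C_)
open import Data.Integer as ℤ using (ℤ)
open import Data.Rational using (ℚ; _+_; _*_; _-_; -_; _/_; 1ℚ)
open import Relation.Binary.PropositionalEquality using (_≡_)

open import Data.Bool using (if_then_else_)
open import Data.Empty using (⊥-elim)
open import Data.Nat using (zero; suc; z≤n; s≤s; _!)
import Data.Nat.Properties as ℕ
open import Data.Nat.Combinatorics
  using ( nCk≡n!/k![n-k]!; k![n∸k]!∣n!; nCk+nC[k+1]≡[n+1]C[k+1]; k>n⇒nCk≡0; nCk≡nC[n∸k]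
        ; nC1≡n; nCn≡1)
open import Data.Nat.Coprimality using (1-coprimeTo)
import Data.Nat.Coprimality as Coprime
open import Data.Nat.Divisibility using (_∣?_; divides; n∣m*n; ∣m+n∣m⇒∣n; ∣-trans)
open import Data.Nat.DivMod using (m≡m%n+[m/n]*n; m%n<n; m*n/n≡m; m/n*n≡m; +-distrib-/-∣ʳ)
open import Data.Nat.Tactic.RingSolver using () renaming (solve-∀ to ℕ-solve-∀)
import Data.Integer.Properties as ℤ
open import Data.Rational using (0ℚ; mkℚ; ½; -½)
open import Data.Rational.Properties
  using ( _≟_; +-*-commutativeRing; normalize-coprime; +-comm; +-assoc; +-identityˡ; +-identityʳ
        ; *-assoc; *-identityˡ; *-zeroˡ; *-zeroʳ; *-distribˡ-+; *-distribʳ-+)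
open import Data.Product using (_×_; _,_; proj₁; proj₂)
open import Level using (0ℓ)
open import Relation.Binary.PropositionalEquality
  using (refl; sym; trans; cong; cong₂; subst; module ≡-Reasoning)
open import Relation.Nullary using (¬_; Dec; yes; no)
open import Relation.Nullary.Decidable using (does; dec⇒maybe; from-no)
open import Tactic.RingSolver using (solve-∀)
open import Tactic.RingSolver.Core.AlmostCommutativeRing
  using (AlmostCommutativeRing; fromCommutativeRing)

ℚ-ring : AlmostCommutativeRing 0ℓ 0ℓ
ℚ-ring = fromCommutativeRing +-*-commutativeRing (λ x → dec⇒maybe (0ℚ ≟ x))

ℕ→ℚ≡mkℚ : ∀ n → ℕ→ℚ n ≡ mkℚ (ℤ.+ n) 0 (Coprime.sym (1-coprimeTo n))
ℕ→ℚ≡mkℚ n = normalize-coprime (Coprime.sym (1-coprimeTo n))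

ℕ→ℚ-+ : ∀ m n → ℕ→ℚ (m ℕ.+ n) ≡ ℕ→ℚ m + ℕ→ℚ n
ℕ→ℚ-+ m n =
  trans (cong (_/ 1) (sym (cong₂ ℤ._+_ (ℤ.*-identityʳ (ℤ.+ m)) (ℤ.*-identityʳ (ℤ.+ n)))))
        (cong₂ _+_ (sym (ℕ→ℚ≡mkℚ m)) (sym (ℕ→ℚ≡mkℚ n)))

ℕ→ℚ-* : ∀ m n → ℕ→ℚ (m ℕ.* n) ≡ ℕ→ℚ m * ℕ→ℚ n
ℕ→ℚ-* m n = trans (cong (_/ 1) (ℤ.pos-* m n)) (cong₂ _*_ (sym (ℕ→ℚ≡mkℚ m)) (sym (ℕ→ℚ≡mkℚ n)))

+n/2≡ℕ→ℚn*½ : ∀ n → ℤ.+ n / 2 ≡ ℕ→ℚ n * ½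
+n/2≡ℕ→ℚn*½ n = trans (cong (_/ 2) (sym (ℤ.*-identityʳ (ℤ.+ n)))) (cong (_* ½) (sym (ℕ→ℚ≡mkℚ n)))

Σ< : ℕ → (ℕ → ℚ) → ℚ
Σ< zero    f = 0ℚ
Σ< (suc n) f = Σ< n f + f n

Σ<-cong : ∀ n {f g : ℕ → ℚ} → (∀ k → k ℕ.< n → f k ≡ g k) → Σ< n f ≡ Σ< n g
Σ<-cong zero    f≗g = refl
Σ<-cong (suc n) f≗g =
  cong₂ _+_ (Σ<-cong n (λ k k<n → f≗g k (ℕ.m<n⇒m<1+n k<n))) (f≗g n (ℕ.n<1+n n))

Σ<-vanishing : ∀ n {f : ℕ → ℚ} → (∀ k → k ℕ.< n → f k ≡ 0ℚ) → Σ< n f ≡ 0ℚ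
Σ<-vanishing zero    f≗0 = refl
Σ<-vanishing (suc n) f≗0 =
  cong₂ _+_ (Σ<-vanishing n (λ k k<n → f≗0 k (ℕ.m<n⇒m<1+n k<n))) (f≗0 n (ℕ.n<1+n n))

Σ<-+ : ∀ n (f g : ℕ → ℚ) → Σ< n (λ k → f k + g k) ≡ Σ< n f + Σ< n g
Σ<-+ zero    f g = refl
Σ<-+ (suc n) f g =
  trans (cong (_+ (f n + g n)) (Σ<-+ n f g)) (+-interchange (Σ< n f) (Σ< n g) (f n) (g n))
  where
  +-interchange : ∀ a b c d → (a + b) + (c + d) ≡ (a + c) + (b + d)
  +-interchange = solve-∀ ℚ-ring

Σ<-*ˡ : ∀ n c (f : ℕ → ℚ) → Σ< n (λ k → c * f k) ≡ c * Σ< n f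
Σ<-*ˡ zero    c f = sym (*-zeroʳ c)
Σ<-*ˡ (suc n) c f = trans (cong (_+ c * f n) (Σ<-*ˡ n c f)) (sym (*-distribˡ-+ c (Σ< n f) (f n)))

Σ<-*ʳ : ∀ n c (f : ℕ → ℚ) → Σ< n (λ k → f k * c) ≡ Σ< n f * c
Σ<-*ʳ zero    c f = sym (*-zeroˡ c)
Σ<-*ʳ (suc n) c f = trans (cong (_+ f n * c) (Σ<-*ʳ n c f)) (sym (*-distribʳ-+ c (Σ< n f) (f n)))

Σ<-suc : ∀ n (f : ℕ → ℚ) → Σ< (suc n) f ≡ f 0 + Σ< n (λ k → f (suc k))
Σ<-suc zero    f = +-comm 0ℚ (f 0)
Σ<-suc (suc n) f = trans (cong (_+ f (suc n)) (Σ<-suc n f)) (+-assoc (f 0) _ _)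

Σ<-triangle : ∀ n (F : ℕ → ℕ → ℚ) →
  Σ< (suc n) (λ k → Σ< k (F k)) ≡ Σ< n (λ j → Σ< (n ∸ j) (λ m → F (n ∸ m) j))
Σ<-triangle zero    F = refl
Σ<-triangle (suc n) F = begin
  Σ< (suc n) (λ k → Σ< k (F k)) + Σ< (suc n) (F (suc n))
    ≡⟨ cong (_+ Σ< (suc n) (F (suc n))) (Σ<-triangle n F) ⟩
  Σ< n inner + Σ< (suc n) (F (suc n))
    ≡⟨ +-comm (Σ< n inner) _ ⟩
  Σ< (suc n) (F (suc n)) + Σ< n inner
    ≡⟨ cong (Σ< (suc n) (F (suc n)) +_) (sym (trans (cong (Σ< n inner +_) inner-n≡0) (+-identityʳ _))) ⟩
  Σ< (suc n) (F (suc n)) + Σ< (suc n) inner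
    ≡⟨ sym (Σ<-+ (suc n) (F (suc n)) inner) ⟩
  Σ< (suc n) (λ j → F (suc n) j + inner j)
    ≡⟨ Σ<-cong (suc n) peel ⟩
  Σ< (suc n) (λ j → Σ< (suc n ∸ j) (λ m → F (suc n ∸ m) j)) ∎
  where
  open ≡-Reasoning
  inner : ℕ → ℚ
  inner j = Σ< (n ∸ j) (λ m → F (n ∸ m) j)
  inner-n≡0 : inner n ≡ 0ℚ
  inner-n≡0 = cong (λ l → Σ< l (λ m → F (n ∸ m) n)) (ℕ.n∸n≡0 n)
  peel : ∀ j → j ℕ.< suc n → F (suc n) j + inner j ≡ Σ< (suc n ∸ j) (λ m → F (suc n ∸ m) j)
  peel j (s≤s j≤n) rewrite ℕ.+-∸-assoc 1 j≤n = sym (Σ<-suc (n ∸ j) (λ m → F (suc n ∸ m) j))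

Σ[≤k≤]≡Σ< : ∀ a b f → Σ[ a ≤k≤ b ] f ≡ Σ< (suc b) (λ k → if does (a ℕ.≤? k) then f k else 0ℚ)
Σ[≤k≤]≡Σ< a zero    f = sym (+-identityˡ _)
Σ[≤k≤]≡Σ< a (suc b) f =
  cong (_+ (if does (a ℕ.≤? suc b) then f (suc b) else 0ℚ)) (Σ[≤k≤]≡Σ< a b f)

nCk*[k!*[n∸k]!]≡n! : ∀ {n k} → k ℕ.≤ n → (n C k) ℕ.* (k ! ℕ.* (n ∸ k) !) ≡ n !
nCk*[k!*[n∸k]!]≡n! {n} {k} k≤n =
  trans (cong (ℕ._* (k ! ℕ.* (n ∸ k) !)) (nCk≡n!/k![n-k]! k≤n))
        (m/n*n≡m {{k ℕ.!* (n ∸ k) !≢0}} (k![n∸k]!∣n! k≤n))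

nC[n∸m]*[n∸m]Cj≡nCj*[n∸j]Cm : ∀ {n} j m → j ℕ.+ m ℕ.≤ n →
  (n C (n ∸ m)) ℕ.* ((n ∸ m) C j) ≡ (n C j) ℕ.* ((n ∸ j) C m)
nC[n∸m]*[n∸m]Cj≡nCj*[n∸j]Cm {n} j m j+m≤n =
  ℕ.*-cancelʳ-≡ _ _ (j ! ℕ.* (m ! ℕ.* d !)) {{nonZero}} (trans lhs≡n! (sym rhs≡n!))
  where
  d : ℕ
  d = n ∸ j ∸ m
  nonZero : ℕ.NonZero (j ! ℕ.* (m ! ℕ.* d !))
  nonZero = ℕ.m*n≢0 _ _ {{j ℕ.!≢0}} {{ℕ.m*n≢0 _ _ {{m ℕ.!≢0}} {{d ℕ.!≢0}}}}
  n∸m∸j≡d : n ∸ m ∸ j ≡ d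
  n∸m∸j≡d = trans (ℕ.∸-+-assoc n m j) (trans (cong (n ∸_) (ℕ.+-comm m j)) (sym (ℕ.∸-+-assoc n j m)))
  [n∸m]Cj-factorials : ((n ∸ m) C j) ℕ.* (j ! ℕ.* d !) ≡ (n ∸ m) !
  [n∸m]Cj-factorials = subst (λ x → ((n ∸ m) C j) ℕ.* (j ! ℕ.* x !) ≡ (n ∸ m) !) n∸m∸j≡d
    (nCk*[k!*[n∸k]!]≡n! (ℕ.m+n≤o⇒m≤o∸n j j+m≤n))
  nC[n∸m]-factorials : (n C (n ∸ m)) ℕ.* ((n ∸ m) ! ℕ.* m !) ≡ n !
  nC[n∸m]-factorials = subst (λ x → (n C (n ∸ m)) ℕ.* ((n ∸ m) ! ℕ.* x !) ≡ n !)
    (ℕ.m∸[m∸n]≡n (ℕ.m+n≤o⇒n≤o j j+m≤n)) (nCk*[k!*[n∸k]!]≡n! (ℕ.m∸n≤m n m))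
  [n∸j]Cm-factorials : ((n ∸ j) C m) ℕ.* (m ! ℕ.* d !) ≡ (n ∸ j) !
  [n∸j]Cm-factorials = nCk*[k!*[n∸k]!]≡n! (ℕ.m+n≤o⇒m≤o∸n m (subst (ℕ._≤ n) (ℕ.+-comm j m) j+m≤n))
  rearrange : ∀ a b c e f → a ℕ.* b ℕ.* (c ℕ.* (e ℕ.* f)) ≡ a ℕ.* (b ℕ.* (c ℕ.* f) ℕ.* e)
  rearrange = ℕ-solve-∀
  rearrange′ : ∀ a b c e f → a ℕ.* b ℕ.* (c ℕ.* (e ℕ.* f)) ≡ a ℕ.* (c ℕ.* (b ℕ.* (e ℕ.* f)))
  rearrange′ = ℕ-solve-∀
  lhs≡n! : (n C (n ∸ m)) ℕ.* ((n ∸ m) C j) ℕ.* (j ! ℕ.* (m ! ℕ.* d !)) ≡ n !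
  lhs≡n! = begin
    (n C (n ∸ m)) ℕ.* ((n ∸ m) C j) ℕ.* (j ! ℕ.* (m ! ℕ.* d !))
      ≡⟨ rearrange (n C (n ∸ m)) ((n ∸ m) C j) (j !) (m !) (d !) ⟩
    (n C (n ∸ m)) ℕ.* (((n ∸ m) C j) ℕ.* (j ! ℕ.* d !) ℕ.* m !)
      ≡⟨ cong (λ x → (n C (n ∸ m)) ℕ.* (x ℕ.* m !)) [n∸m]Cj-factorials ⟩
    (n C (n ∸ m)) ℕ.* ((n ∸ m) ! ℕ.* m !)
      ≡⟨ nC[n∸m]-factorials ⟩
    n ! ∎
    where open ≡-Reasoning
  rhs≡n! : (n C j) ℕ.* ((n ∸ j) C m) ℕ.* (j ! ℕ.* (m ! ℕ.* d !)) ≡ n !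
  rhs≡n! = begin
    (n C j) ℕ.* ((n ∸ j) C m) ℕ.* (j ! ℕ.* (m ! ℕ.* d !))
      ≡⟨ rearrange′ (n C j) ((n ∸ j) C m) (j !) (m !) (d !) ⟩
    (n C j) ℕ.* (j ! ℕ.* (((n ∸ j) C m) ℕ.* (m ! ℕ.* d !)))
      ≡⟨ cong (λ x → (n C j) ℕ.* (j ! ℕ.* x)) [n∸j]Cm-factorials ⟩
    (n C j) ℕ.* (j ! ℕ.* (n ∸ j) !)
      ≡⟨ nCk*[k!*[n∸k]!]≡n! (ℕ.m+n≤o⇒m≤o j j+m≤n) ⟩
    n ! ∎
    where open ≡-Reasoning

binomialSum< binomialSum : (ℕ → ℚ) → ℕ → ℚ
binomialSum< a k = Σ< k (λ j → ℕ→ℚ (k C j) * a j)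
binomialSum  a k = Σ< (suc k) (λ j → ℕ→ℚ (k C j) * a j)

binomialSum<-convolution : ∀ (a b : ℕ → ℚ) n →
  Σ< (suc n) (λ k → ℕ→ℚ (n C k) * (binomialSum< a k * b (n ∸ k)))
    ≡ Σ< n (λ j → ℕ→ℚ (n C j) * a j * binomialSum< b (n ∸ j))
binomialSum<-convolution a b n = begin
  Σ< (suc n) (λ k → ℕ→ℚ (n C k) * (binomialSum< a k * b (n ∸ k)))
    ≡⟨ Σ<-cong (suc n) (λ k _ → expand k) ⟩
  Σ< (suc n) (λ k → Σ< k (F k))
    ≡⟨ Σ<-triangle n F ⟩
  Σ< n (λ j → Σ< (n ∸ j) (λ m → F (n ∸ m) j))
    ≡⟨ Σ<-cong n (λ j _ → trans (Σ<-cong (n ∸ j) (regroup j))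
                                 (Σ<-*ˡ (n ∸ j) (ℕ→ℚ (n C j) * a j) (λ m → ℕ→ℚ ((n ∸ j) C m) * b m))) ⟩
  Σ< n (λ j → ℕ→ℚ (n C j) * a j * binomialSum< b (n ∸ j)) ∎
  where
  open ≡-Reasoning
  F : ℕ → ℕ → ℚ
  F k j = ℕ→ℚ (n C k) * (ℕ→ℚ (k C j) * a j * b (n ∸ k))
  expand : ∀ k → ℕ→ℚ (n C k) * (binomialSum< a k * b (n ∸ k)) ≡ Σ< k (F k)
  expand k = trans (cong (ℕ→ℚ (n C k) *_) (sym (Σ<-*ʳ k (b (n ∸ k)) (λ j → ℕ→ℚ (k C j) * a j))))
                   (sym (Σ<-*ˡ k (ℕ→ℚ (n C k)) (λ j → ℕ→ℚ (k C j) * a j * b (n ∸ k))))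
  regroup : ∀ j m → m ℕ.< n ∸ j → F (n ∸ m) j ≡ ℕ→ℚ (n C j) * a j * (ℕ→ℚ ((n ∸ j) C m) * b m)
  regroup j m m<n∸j = begin
    ℕ→ℚ (n C (n ∸ m)) * (ℕ→ℚ ((n ∸ m) C j) * a j * b (n ∸ (n ∸ m)))
      ≡⟨ cong (λ l → ℕ→ℚ (n C (n ∸ m)) * (ℕ→ℚ ((n ∸ m) C j) * a j * b l)) (ℕ.m∸[m∸n]≡n m≤n) ⟩
    ℕ→ℚ (n C (n ∸ m)) * (ℕ→ℚ ((n ∸ m) C j) * a j * b m)
      ≡⟨ pull-coefficients (ℕ→ℚ (n C (n ∸ m))) (ℕ→ℚ ((n ∸ m) C j)) (a j) (b m) ⟩
    ℕ→ℚ (n C (n ∸ m)) * ℕ→ℚ ((n ∸ m) C j) * (a j * b m)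
      ≡⟨ cong (_* (a j * b m)) coefficients ⟩
    ℕ→ℚ (n C j) * ℕ→ℚ ((n ∸ j) C m) * (a j * b m)
      ≡⟨ push-coefficients (ℕ→ℚ (n C j)) (ℕ→ℚ ((n ∸ j) C m)) (a j) (b m) ⟩
    ℕ→ℚ (n C j) * a j * (ℕ→ℚ ((n ∸ j) C m) * b m) ∎
    where
    j≤n : j ℕ.≤ n
    j≤n = ℕ.<⇒≤ (ℕ.m∸n≢0⇒n<m (λ n∸j≡0 → ℕ.n≮0 (subst (m ℕ.<_) n∸j≡0 m<n∸j)))
    j+m≤n : j ℕ.+ m ℕ.≤ n
    j+m≤n = subst (ℕ._≤ n) (ℕ.+-comm m j) (ℕ.m≤o∸n⇒m+n≤o m j≤n (ℕ.<⇒≤ m<n∸j))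
    m≤n : m ℕ.≤ n
    m≤n = ℕ.m+n≤o⇒n≤o j j+m≤n
    coefficients : ℕ→ℚ (n C (n ∸ m)) * ℕ→ℚ ((n ∸ m) C j) ≡ ℕ→ℚ (n C j) * ℕ→ℚ ((n ∸ j) C m)
    coefficients = trans (sym (ℕ→ℚ-* (n C (n ∸ m)) ((n ∸ m) C j)))
      (trans (cong ℕ→ℚ (nC[n∸m]*[n∸m]Cj≡nCj*[n∸j]Cm j m j+m≤n)) (ℕ→ℚ-* (n C j) ((n ∸ j) C m)))
    pull-coefficients : ∀ x y z w → x * (y * z * w) ≡ x * y * (z * w)
    pull-coefficients = solve-∀ ℚ-ring
    push-coefficients : ∀ x y z w → x * y * (z * w) ≡ x * z * (y * w)
    push-coefficients = solve-∀ ℚ-ring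

[1+n]Cn≡1+n : ∀ n → suc n C n ≡ suc n
[1+n]Cn≡1+n n =
  trans (nCk≡nC[n∸k] (ℕ.n≤1+n n)) (trans (cong (suc n C_) (ℕ.m+n∸n≡m 1 n)) (nC1≡n (suc n)))

module _ {B : ℕ → ℚ} (isBernoulli : IsBernoulli B) where

  binomialSum<-B-2+ : ∀ n → binomialSum< B (suc (suc n)) ≡ 0ℚ
  binomialSum<-B-2+ n =
    trans (sym (Σ[≤k≤]≡Σ< 0 (suc n) _)) (proj₂ isBernoulli (suc (suc n)) (s≤s (s≤s z≤n)))

  binomialSum<-B-1 : binomialSum< B 1 ≡ 1ℚ
  binomialSum<-B-1 = cong (λ x → 0ℚ + ℕ→ℚ 1 * x) (proj₁ isBernoulli)

  bernoulli-inversion : ∀ (a : ℕ → ℚ) n →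
    Σ< (suc (suc n)) (λ k → ℕ→ℚ (suc n C k) * (binomialSum< a k * B (suc n ∸ k))) ≡ ℕ→ℚ (suc n) * a n
  bernoulli-inversion a n = begin
    Σ< (suc (suc n)) (λ k → ℕ→ℚ (suc n C k) * (binomialSum< a k * B (suc n ∸ k)))
      ≡⟨ binomialSum<-convolution a B (suc n) ⟩
    Σ< n term + ℕ→ℚ (suc n C n) * a n * binomialSum< B (suc n ∸ n)
      ≡⟨ cong₂ _+_ (Σ<-vanishing n vanish)
                   (cong₂ (λ c l → ℕ→ℚ c * a n * binomialSum< B l) ([1+n]Cn≡1+n n) (ℕ.m+n∸n≡m 1 n)) ⟩
    0ℚ + ℕ→ℚ (suc n) * a n * binomialSum< B 1
      ≡⟨ cong (λ x → 0ℚ + ℕ→ℚ (suc n) * a n * x) binomialSum<-B-1 ⟩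
    0ℚ + ℕ→ℚ (suc n) * a n * 1ℚ
      ≡⟨ simplify (ℕ→ℚ (suc n)) (a n) ⟩
    ℕ→ℚ (suc n) * a n ∎
    where
    open ≡-Reasoning
    term : ℕ → ℚ
    term j = ℕ→ℚ (suc n C j) * a j * binomialSum< B (suc n ∸ j)
    vanish : ∀ j → j ℕ.< n → term j ≡ 0ℚ
    vanish j j<n = trans (cong (λ l → ℕ→ℚ (suc n C j) * a j * binomialSum< B l) 1+n∸j≡2+n∸[1+j])
      (trans (cong (ℕ→ℚ (suc n C j) * a j *_) (binomialSum<-B-2+ (n ∸ suc j)))
             (*-zeroʳ (ℕ→ℚ (suc n C j) * a j)))
      where
      1+n∸j≡2+n∸[1+j] : suc n ∸ j ≡ suc (suc (n ∸ suc j))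
      1+n∸j≡2+n∸[1+j] = trans (ℕ.+-∸-assoc 1 (ℕ.<⇒≤ j<n)) (cong suc (ℕ.+-∸-assoc 1 j<n))
    simplify : ∀ x y → 0ℚ + x * y * 1ℚ ≡ x * y
    simplify = solve-∀ ℚ-ring

binomialSum-+ : ∀ (a b : ℕ → ℚ) k → binomialSum (λ j → a j + b j) k ≡ binomialSum a k + binomialSum b k
binomialSum-+ a b k = trans (Σ<-cong (suc k) (λ j _ → *-distribˡ-+ (ℕ→ℚ (k C j)) (a j) (b j)))
                            (Σ<-+ (suc k) (λ j → ℕ→ℚ (k C j) * a j) (λ j → ℕ→ℚ (k C j) * b j))

binomialSum-*ˡ : ∀ c (a : ℕ → ℚ) k → binomialSum (λ j → c * a j) k ≡ c * binomialSum a k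
binomialSum-*ˡ c a k = trans (Σ<-cong (suc k) (λ j _ → swap (ℕ→ℚ (k C j)) c (a j)))
                             (Σ<-*ˡ (suc k) c (λ j → ℕ→ℚ (k C j) * a j))
  where
  swap : ∀ x y z → x * (y * z) ≡ y * (x * z)
  swap = solve-∀ ℚ-ring

binomialSum-suc : ∀ (a : ℕ → ℚ) k →
  binomialSum a (suc k) ≡ binomialSum a k + binomialSum (λ j → a (suc j)) k
binomialSum-suc a k = begin
  binomialSum a (suc k)
    ≡⟨ Σ<-suc (suc k) (λ j → ℕ→ℚ (suc k C j) * a j) ⟩
  ℕ→ℚ 1 * a 0 + Σ< (suc k) (λ j → ℕ→ℚ (suc k C suc j) * a (suc j))
    ≡⟨ cong (ℕ→ℚ 1 * a 0 +_) (trans (Σ<-cong (suc k) (λ j _ → pascal j))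
         (Σ<-+ (suc k) (λ j → ℕ→ℚ (k C j) * a (suc j)) (λ j → ℕ→ℚ (k C suc j) * a (suc j)))) ⟩
  ℕ→ℚ 1 * a 0 + (X + (W + ℕ→ℚ (k C suc k) * a (suc k)))
    ≡⟨ cong (λ c → ℕ→ℚ 1 * a 0 + (X + (W + ℕ→ℚ c * a (suc k)))) (k>n⇒nCk≡0 (ℕ.n<1+n k)) ⟩
  ℕ→ℚ 1 * a 0 + (X + (W + ℕ→ℚ 0 * a (suc k)))
    ≡⟨ rearrange (ℕ→ℚ 1 * a 0) X W (a (suc k)) ⟩
  ℕ→ℚ 1 * a 0 + W + X
    ≡⟨ cong (_+ X) (sym (Σ<-suc k (λ j → ℕ→ℚ (k C j) * a j))) ⟩
  binomialSum a k + X ∎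
  where
  open ≡-Reasoning
  X W : ℚ
  X = binomialSum (λ j → a (suc j)) k
  W = Σ< k (λ j → ℕ→ℚ (k C suc j) * a (suc j))
  pascal : ∀ j →
    ℕ→ℚ (suc k C suc j) * a (suc j) ≡ ℕ→ℚ (k C j) * a (suc j) + ℕ→ℚ (k C suc j) * a (suc j)
  pascal j = begin
    ℕ→ℚ (suc k C suc j) * a (suc j)
      ≡⟨ cong (λ c → ℕ→ℚ c * a (suc j)) (sym (nCk+nC[k+1]≡[n+1]C[k+1] k j)) ⟩
    ℕ→ℚ (k C j ℕ.+ k C suc j) * a (suc j)
      ≡⟨ cong (_* a (suc j)) (ℕ→ℚ-+ (k C j) (k C suc j)) ⟩
    (ℕ→ℚ (k C j) + ℕ→ℚ (k C suc j)) * a (suc j)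
      ≡⟨ *-distribʳ-+ (a (suc j)) (ℕ→ℚ (k C j)) (ℕ→ℚ (k C suc j)) ⟩
    ℕ→ℚ (k C j) * a (suc j) + ℕ→ℚ (k C suc j) * a (suc j) ∎
  rearrange : ∀ a₀ x w y → a₀ + (x + (w + ℕ→ℚ 0 * y)) ≡ a₀ + w + x
  rearrange = solve-∀ ℚ-ring

binomialSum-linear : ∀ c d (a b : ℕ → ℚ) k →
  binomialSum (λ j → c * a j + d * b j) k ≡ c * binomialSum a k + d * binomialSum b k
binomialSum-linear c d a b k = trans (binomialSum-+ (λ j → c * a j) (λ j → d * b j) k)
                                     (cong₂ _+_ (binomialSum-*ˡ c a k) (binomialSum-*ˡ d b k))

binomialSum<≡binomialSum-last : ∀ (a : ℕ → ℚ) k → binomialSum< a k ≡ binomialSum a k - a k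
binomialSum<≡binomialSum-last a k =
  trans (cancel (binomialSum< a k) (a k))
        (cong (λ c → binomialSum< a k + ℕ→ℚ c * a k - a k) (sym (nCn≡1 k)))
  where
  cancel : ∀ x y → x ≡ x + ℕ→ℚ 1 * y - y
  cancel = solve-∀ ℚ-ring

infix 5 _+i_
record ℚ[i] : Set where
  constructor _+i_
  field re im : ℚ
open ℚ[i]

infixl 7 _·_
_·_ : ℚ[i] → ℚ[i] → ℚ[i]
z · w = re z * re w + (- im z) * im w +i im z * re w + re z * im w

infixr 8 _^_
_^_ : ℚ[i] → ℕ → ℚ[i]
w ^ zero  = 1ℚ +i 0ℚ
w ^ suc n = w · w ^ n

1+_ : ℚ[i] → ℚ[i]
1+ w = 1ℚ + re w +i im w

·-assoc : ∀ x y z → x · (y · z) ≡ (x · y) · z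
·-assoc x y z = cong₂ _+i_ (re-assoc (re x) (im x) (re y) (im y) (re z) (im z))
                           (im-assoc (re x) (im x) (re y) (im y) (re z) (im z))
  where
  re-assoc : ∀ a b c d e f → a * (c * e + (- d) * f) + (- b) * (d * e + c * f)
                             ≡ (a * c + (- b) * d) * e + (- (b * c + a * d)) * f
  re-assoc = solve-∀ ℚ-ring
  im-assoc : ∀ a b c d e f → b * (c * e + (- d) * f) + a * (d * e + c * f)
                             ≡ (b * c + a * d) * e + (a * c + (- b) * d) * f
  im-assoc = solve-∀ ℚ-ring

^-+ : ∀ w m n → w ^ (m ℕ.+ n) ≡ w ^ m · w ^ n
^-+ w zero    n = cong₂ _+i_ (left-unit (re (w ^ n)) (im (w ^ n))) (right-unit (re (w ^ n)) (im (w ^ n)))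
  where
  left-unit : ∀ a b → a ≡ 1ℚ * a + (- 0ℚ) * b
  left-unit = solve-∀ ℚ-ring
  right-unit : ∀ a b → b ≡ 0ℚ * a + 1ℚ * b
  right-unit = solve-∀ ℚ-ring
^-+ w (suc m) n = trans (cong (w ·_) (^-+ w m n)) (·-assoc w (w ^ m) (w ^ n))

^-multiple-of-4 : ∀ {w c} → w ^ 4 ≡ c +i 0ℚ → ∀ t → w ^ (t ℕ.* 4) ≡ c ^ℚ t +i 0ℚ
^-multiple-of-4         w⁴≡c zero    = refl
^-multiple-of-4 {w} {c} w⁴≡c (suc t) = begin
  w ^ (4 ℕ.+ t ℕ.* 4)       ≡⟨ ^-+ w 4 (t ℕ.* 4) ⟩
  w ^ 4 · w ^ (t ℕ.* 4)     ≡⟨ cong₂ _·_ w⁴≡c (^-multiple-of-4 w⁴≡c t) ⟩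
  (c +i 0ℚ) · (c ^ℚ t +i 0ℚ) ≡⟨ cong₂ _+i_ (real-re c (c ^ℚ t)) (real-im c (c ^ℚ t)) ⟩
  c ^ℚ suc t +i 0ℚ          ∎
  where
  open ≡-Reasoning
  real-re : ∀ x y → x * y + (- 0ℚ) * 0ℚ ≡ x * y
  real-re = solve-∀ ℚ-ring
  real-im : ∀ x y → 0ℚ * y + x * 0ℚ ≡ 0ℚ
  real-im = solve-∀ ℚ-ring

rePow : ℚ[i] → ℕ → ℚ
rePow w j = re (w ^ j)

rePow-periodic : ∀ w c → w ^ 4 ≡ c +i 0ℚ → ∀ r t → rePow w (r ℕ.+ t ℕ.* 4) ≡ c ^ℚ t * rePow w r
rePow-periodic w c w⁴≡c r t = begin
  re (w ^ (r ℕ.+ t ℕ.* 4))                           ≡⟨ cong re (^-+ w r (t ℕ.* 4)) ⟩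
  re (w ^ r · w ^ (t ℕ.* 4))                          ≡⟨ cong (λ z → re (w ^ r · z)) (^-multiple-of-4 w⁴≡c t) ⟩
  re (w ^ r) * c ^ℚ t + (- im (w ^ r)) * 0ℚ          ≡⟨ scale (re (w ^ r)) (im (w ^ r)) (c ^ℚ t) ⟩
  c ^ℚ t * re (w ^ r)                                 ∎
  where
  open ≡-Reasoning
  scale : ∀ a b x → a * x + (- b) * 0ℚ ≡ x * a
  scale = solve-∀ ℚ-ring

binomialSum-^ : ∀ w k → binomialSum (λ j → re (w ^ j)) k ≡ re ((1+ w) ^ k)
                      × binomialSum (λ j → im (w ^ j)) k ≡ im ((1+ w) ^ k)
binomialSum-^ w zero    = refl , refl
binomialSum-^ w (suc k) = re-step , im-step
  where
  R I R′ I′ : ℚ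
  R = binomialSum (λ j → re (w ^ j)) k
  I = binomialSum (λ j → im (w ^ j)) k
  R′ = re ((1+ w) ^ k)
  I′ = im ((1+ w) ^ k)
  R≡R′ : R ≡ R′
  R≡R′ = proj₁ (binomialSum-^ w k)
  I≡I′ : I ≡ I′
  I≡I′ = proj₂ (binomialSum-^ w k)
  re-step : binomialSum (λ j → re (w ^ j)) (suc k) ≡ re ((1+ w) ^ suc k)
  re-step = begin
    binomialSum (λ j → re (w ^ j)) (suc k)
      ≡⟨ binomialSum-suc (λ j → re (w ^ j)) k ⟩
    R + binomialSum (λ j → re w * re (w ^ j) + (- im w) * im (w ^ j)) k
      ≡⟨ cong (R +_) (binomialSum-linear (re w) (- im w) (λ j → re (w ^ j)) (λ j → im (w ^ j)) k) ⟩
    R + (re w * R + (- im w) * I)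
      ≡⟨ cong₂ (λ x y → x + (re w * x + (- im w) * y)) R≡R′ I≡I′ ⟩
    R′ + (re w * R′ + (- im w) * I′)
      ≡⟨ collect (re w) (im w) R′ I′ ⟩
    (1ℚ + re w) * R′ + (- im w) * I′ ∎
    where
    open ≡-Reasoning
    collect : ∀ a b x y → x + (a * x + (- b) * y) ≡ (1ℚ + a) * x + (- b) * y
    collect = solve-∀ ℚ-ring
  im-step : binomialSum (λ j → im (w ^ j)) (suc k) ≡ im ((1+ w) ^ suc k)
  im-step = begin
    binomialSum (λ j → im (w ^ j)) (suc k)
      ≡⟨ binomialSum-suc (λ j → im (w ^ j)) k ⟩
    I + binomialSum (λ j → im w * re (w ^ j) + re w * im (w ^ j)) k
      ≡⟨ cong (I +_) (binomialSum-linear (im w) (re w) (λ j → re (w ^ j)) (λ j → im (w ^ j)) k) ⟩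
    I + (im w * R + re w * I)
      ≡⟨ cong₂ (λ x y → y + (im w * x + re w * y)) R≡R′ I≡I′ ⟩
    I′ + (im w * R′ + re w * I′)
      ≡⟨ collect (re w) (im w) R′ I′ ⟩
    im w * R′ + (1ℚ + re w) * I′ ∎
    where
    open ≡-Reasoning
    collect : ∀ a b x y → y + (b * x + a * y) ≡ b * x + (1ℚ + a) * y
    collect = solve-∀ ℚ-ring

i -1ᵍ i-1 0ᵍ 1ᵍ : ℚ[i]
i   = 0ℚ +i 1ℚ
-1ᵍ = - 1ℚ +i 0ℚ
i-1 = - 1ℚ +i 1ℚ
0ᵍ  = 0ℚ +i 0ℚ
1ᵍ  = 1ℚ +i 0ℚ

g : ℕ → ℚ
g j = ½ * (rePow i j + rePow -1ᵍ j) + -½ * (rePow i-1 j + rePow 0ᵍ j)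

binomialSum-g : ∀ k → binomialSum g k ≡
  ½ * (rePow (1+ i) k + rePow (1+ -1ᵍ) k) + -½ * (rePow (1+ i-1) k + rePow (1+ 0ᵍ) k)
binomialSum-g k =
  trans (binomialSum-linear ½ -½ (λ j → rePow i j + rePow -1ᵍ j) (λ j → rePow i-1 j + rePow 0ᵍ j) k)
        (cong₂ (λ x y → ½ * x + -½ * y) (binomialSum-rePow+rePow i -1ᵍ) (binomialSum-rePow+rePow i-1 0ᵍ))
  where
  binomialSum-rePow+rePow : ∀ v w →
    binomialSum (λ j → rePow v j + rePow w j) k ≡ rePow (1+ v) k + rePow (1+ w) k
  binomialSum-rePow+rePow v w = trans (binomialSum-+ (rePow v) (rePow w) k)
                              (cong₂ _+_ (proj₁ (binomialSum-^ v k)) (proj₁ (binomialSum-^ w k)))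

-- Uses that 1+ -1ᵍ, 1+ i-1 and 1+ 0ᵍ reduce to 0ᵍ, i and 1ᵍ.
binomialSum<-g : ∀ k → binomialSum< g k ≡
  ½ * (rePow (1+ i) k + rePow i-1 k) + rePow 0ᵍ k - rePow i k - ½ * (rePow 1ᵍ k + rePow -1ᵍ k)
binomialSum<-g k = trans (binomialSum<≡binomialSum-last g k) (trans (cong (_- g k) (binomialSum-g k))
  (regroup (rePow (1+ i) k) (rePow 0ᵍ k) (rePow i k) (rePow 1ᵍ k) (rePow -1ᵍ k) (rePow i-1 k)))
  where
  regroup : ∀ a z c d e f → ½ * (a + z) + -½ * (c + d) - (½ * (c + e) + -½ * (f + z))
                            ≡ ½ * (a + f) + z - c - ½ * (d + e)
  regroup = solve-∀ ℚ-ring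

1ℚ^ℚ : ∀ t → 1ℚ ^ℚ t ≡ 1ℚ
1ℚ^ℚ zero    = refl
1ℚ^ℚ (suc t) = trans (*-identityˡ (1ℚ ^ℚ t)) (1ℚ^ℚ t)

rePow-periodic-1 : ∀ w → w ^ 4 ≡ 1ℚ +i 0ℚ → ∀ r t → rePow w (r ℕ.+ t ℕ.* 4) ≡ rePow w r
rePow-periodic-1 w w⁴≡1 r t =
  trans (rePow-periodic w 1ℚ w⁴≡1 r t) (trans (cong (_* rePow w r) (1ℚ^ℚ t)) (*-identityˡ (rePow w r)))

rePow-0ᵍ-suc : ∀ k → rePow 0ᵍ (suc k) ≡ 0ℚ
rePow-0ᵍ-suc k = annihilate (re (0ᵍ ^ k)) (im (0ᵍ ^ k))
  where
  annihilate : ∀ x y → 0ℚ * x + (- 0ℚ) * y ≡ 0ℚ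
  annihilate = solve-∀ ℚ-ring

-- Residues are taken in 1..4 rather than 0..3 so that the 0ᵍ term always vanishes.
binomialSum<-g-periodic : ∀ r t → binomialSum< g (suc r ℕ.+ t ℕ.* 4) ≡
  ½ * ((- ℕ→ℚ 4) ^ℚ t * rePow (1+ i) (suc r) + (- ℕ→ℚ 4) ^ℚ t * rePow i-1 (suc r))
  - rePow i (suc r) - ½ * (rePow 1ᵍ (suc r) + rePow -1ᵍ (suc r))
binomialSum<-g-periodic r t = begin
  binomialSum< g k
    ≡⟨ binomialSum<-g k ⟩
  ½ * (rePow (1+ i) k + rePow i-1 k) + rePow 0ᵍ k - rePow i k - ½ * (rePow 1ᵍ k + rePow -1ᵍ k)
    ≡⟨ cong₂ (λ x y → ½ * x + rePow 0ᵍ k - rePow i k - ½ * y)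
         (cong₂ _+_ (rePow-periodic (1+ i) (- ℕ→ℚ 4) refl s t) (rePow-periodic i-1 (- ℕ→ℚ 4) refl s t))
         (cong₂ _+_ (rePow-periodic-1 1ᵍ refl s t) (rePow-periodic-1 -1ᵍ refl s t)) ⟩
  A + rePow 0ᵍ k - rePow i k - D
    ≡⟨ cong₂ (λ x y → A + x - y - D) (rePow-0ᵍ-suc (r ℕ.+ t ℕ.* 4)) (rePow-periodic-1 i refl s t) ⟩
  A + 0ℚ - rePow i s - D
    ≡⟨ drop-zero A (rePow i s) D ⟩
  A - rePow i s - D ∎
  where
  open ≡-Reasoning
  s k : ℕ
  s = suc r
  k = s ℕ.+ t ℕ.* 4
  A D : ℚ
  A = ½ * ((- ℕ→ℚ 4) ^ℚ t * rePow (1+ i) s + (- ℕ→ℚ 4) ^ℚ t * rePow i-1 s)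
  D = ½ * (rePow 1ᵍ s + rePow -1ᵍ s)
  drop-zero : ∀ x y z → x + 0ℚ - y - z ≡ x - y - z
  drop-zero = solve-∀ ℚ-ring

g-periodic : ∀ r t → g (suc r ℕ.+ t ℕ.* 4) ≡
  ½ * (rePow i (suc r) + rePow -1ᵍ (suc r)) + -½ * ((- ℕ→ℚ 4) ^ℚ t * rePow i-1 (suc r))
g-periodic r t = cong₂ (λ x y → ½ * x + -½ * y)
  (cong₂ _+_ (rePow-periodic-1 i refl (suc r) t) (rePow-periodic-1 -1ᵍ refl (suc r) t))
  (trans (cong₂ _+_ (rePow-periodic i-1 (- ℕ→ℚ 4) refl (suc r) t) (rePow-0ᵍ-suc (r ℕ.+ t ℕ.* 4)))
         (+-identityʳ ((- ℕ→ℚ 4) ^ℚ t * rePow i-1 (suc r))))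

-- In each `evaluate` the closed values rePow w r are computed by the solver's normalisation.
binomialSum<-g-[4+4t] : ∀ t → binomialSum< g (suc t ℕ.* 4) ≡ (- ℕ→ℚ 4) ^ℚ suc t - ℕ→ℚ 2
binomialSum<-g-[4+4t] t = trans (binomialSum<-g-periodic 3 t) (evaluate ((- ℕ→ℚ 4) ^ℚ t))
  where
  evaluate : ∀ p →
    ½ * (p * rePow (1+ i) 4 + p * rePow i-1 4) - rePow i 4 - ½ * (rePow 1ᵍ 4 + rePow -1ᵍ 4) ≡ - ℕ→ℚ 4 * p - ℕ→ℚ 2
  evaluate = solve-∀ ℚ-ring

binomialSum<-g-[1+4t] : ∀ t → binomialSum< g (1 ℕ.+ t ℕ.* 4) ≡ 0ℚ
binomialSum<-g-[1+4t] t = trans (binomialSum<-g-periodic 0 t) (evaluate ((- ℕ→ℚ 4) ^ℚ t))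
  where
  evaluate : ∀ p →
    ½ * (p * rePow (1+ i) 1 + p * rePow i-1 1) - rePow i 1 - ½ * (rePow 1ᵍ 1 + rePow -1ᵍ 1) ≡ 0ℚ
  evaluate = solve-∀ ℚ-ring

binomialSum<-g-[2+4t] : ∀ t → binomialSum< g (2 ℕ.+ t ℕ.* 4) ≡ 0ℚ
binomialSum<-g-[2+4t] t = trans (binomialSum<-g-periodic 1 t) (evaluate ((- ℕ→ℚ 4) ^ℚ t))
  where
  evaluate : ∀ p →
    ½ * (p * rePow (1+ i) 2 + p * rePow i-1 2) - rePow i 2 - ½ * (rePow 1ᵍ 2 + rePow -1ᵍ 2) ≡ 0ℚ
  evaluate = solve-∀ ℚ-ring

binomialSum<-g-[3+4t] : ∀ t → binomialSum< g (3 ℕ.+ t ℕ.* 4) ≡ 0ℚ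
binomialSum<-g-[3+4t] t = trans (binomialSum<-g-periodic 2 t) (evaluate ((- ℕ→ℚ 4) ^ℚ t))
  where
  evaluate : ∀ p →
    ½ * (p * rePow (1+ i) 3 + p * rePow i-1 3) - rePow i 3 - ½ * (rePow 1ᵍ 3 + rePow -1ᵍ 3) ≡ 0ℚ
  evaluate = solve-∀ ℚ-ring

g-[1+4t] : ∀ t → g (1 ℕ.+ t ℕ.* 4) ≡ ½ * ((- ℕ→ℚ 4) ^ℚ t - 1ℚ)
g-[1+4t] t = trans (g-periodic 0 t) (evaluate ((- ℕ→ℚ 4) ^ℚ t))
  where
  evaluate : ∀ p → ½ * (rePow i 1 + rePow -1ᵍ 1) + -½ * (p * rePow i-1 1) ≡ ½ * (p - 1ℚ)
  evaluate = solve-∀ ℚ-ring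

g-[3+4t] : ∀ t → g (3 ℕ.+ t ℕ.* 4) ≡ ½ * (- ℕ→ℚ 2 * (- ℕ→ℚ 4) ^ℚ t - 1ℚ)
g-[3+4t] t = trans (g-periodic 2 t) (evaluate ((- ℕ→ℚ 4) ^ℚ t))
  where
  evaluate : ∀ p → ½ * (rePow i 3 + rePow -1ᵍ 3) + -½ * (p * rePow i-1 3) ≡ ½ * (- ℕ→ℚ 2 * p - 1ℚ)
  evaluate = solve-∀ ℚ-ring

mod-4-elim : (P : ℕ → Set) → (∀ t → P (t ℕ.* 4)) → (∀ t → P (1 ℕ.+ t ℕ.* 4)) →
             (∀ t → P (2 ℕ.+ t ℕ.* 4)) → (∀ t → P (3 ℕ.+ t ℕ.* 4)) → ∀ n → P n
mod-4-elim P p₀ p₁ p₂ p₃ n = subst P (sym (m≡m%n+[m/n]*n n 4)) (by-residue (n ℕ.% 4) (m%n<n n 4))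
  where
  by-residue : ∀ r → r ℕ.< 4 → P (r ℕ.+ n ℕ./ 4 ℕ.* 4)
  by-residue 0 _ = p₀ (n ℕ./ 4)
  by-residue 1 _ = p₁ (n ℕ./ 4)
  by-residue 2 _ = p₂ (n ℕ./ 4)
  by-residue 3 _ = p₃ (n ℕ./ 4)
  by-residue (suc (suc (suc (suc _)))) (s≤s (s≤s (s≤s (s≤s ()))))

binomialSum<-g-multiple-of-4 : ∀ k → 4 ∣ suc k →
  binomialSum< g (suc k) ≡ (- ℕ→ℚ 4) ^ℚ (suc k ℕ./ 4) - ℕ→ℚ 2
binomialSum<-g-multiple-of-4 k (divides (suc t) refl) =
  trans (binomialSum<-g-[4+4t] t) (cong (λ q → (- ℕ→ℚ 4) ^ℚ q - ℕ→ℚ 2) (sym (m*n/n≡m (suc t) 4)))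

binomialSum<-g-non-multiple-of-4 : ∀ k → ¬ 4 ∣ suc k → binomialSum< g (suc k) ≡ 0ℚ
binomialSum<-g-non-multiple-of-4 = mod-4-elim (λ k → ¬ 4 ∣ suc k → binomialSum< g (suc k) ≡ 0ℚ)
  (λ t _ → binomialSum<-g-[1+4t] t)
  (λ t _ → binomialSum<-g-[2+4t] t)
  (λ t _ → binomialSum<-g-[3+4t] t)
  (λ t 4∤4+4t → ⊥-elim (4∤4+4t (n∣m*n (suc t))))

sumDiv≡Σ<-binomialSum< : ∀ (b : ℕ → ℚ) n →
  sumDiv 1 n 4 (λ k → ℕ→ℚ (n C k) * (((- ℕ→ℚ 4) ^ℚ (k ℕ./ 4) - ℕ→ℚ 2) * b (n ∸ k)))
    ≡ Σ< (suc n) (λ k → ℕ→ℚ (n C k) * (binomialSum< g k * b (n ∸ k)))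
sumDiv≡Σ<-binomialSum< b n = trans (Σ[≤k≤]≡Σ< 1 n _) (Σ<-cong (suc n) (λ k _ → summand k))
  where
  annihilate : ∀ x y → x * (0ℚ * y) ≡ 0ℚ
  annihilate = solve-∀ ℚ-ring
  summand : ∀ k →
    (if does (1 ℕ.≤? k)
       then (if does (4 ∣? k) then ℕ→ℚ (n C k) * (((- ℕ→ℚ 4) ^ℚ (k ℕ./ 4) - ℕ→ℚ 2) * b (n ∸ k)) else 0ℚ)
       else 0ℚ)
    ≡ ℕ→ℚ (n C k) * (binomialSum< g k * b (n ∸ k))
  summand zero    = sym (annihilate (ℕ→ℚ (n C 0)) (b n))
  summand (suc k) = by-divisibility (4 ∣? suc k)
    where
    c : ℚ
    c = ℕ→ℚ (n C suc k)
    by-divisibility : (d : Dec (4 ∣ suc k)) →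
      (if does d then c * (((- ℕ→ℚ 4) ^ℚ (suc k ℕ./ 4) - ℕ→ℚ 2) * b (n ∸ suc k)) else 0ℚ)
      ≡ c * (binomialSum< g (suc k) * b (n ∸ suc k))
    by-divisibility (yes 4∣1+k) =
      cong (λ x → c * (x * b (n ∸ suc k))) (sym (binomialSum<-g-multiple-of-4 k 4∣1+k))
    by-divisibility (no  4∤1+k) =
      sym (trans (cong (λ x → c * (x * b (n ∸ suc k))) (binomialSum<-g-non-multiple-of-4 k 4∤1+k))
                 (annihilate c (b (n ∸ suc k))))

[-1]^t*2^[t*2]≡[-4]^t : ∀ t → (- 1ℚ) ^ℚ t * ℕ→ℚ 2 ^ℚ (t ℕ.* 2) ≡ (- ℕ→ℚ 4) ^ℚ t
[-1]^t*2^[t*2]≡[-4]^t zero    = refl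
[-1]^t*2^[t*2]≡[-4]^t (suc t) =
  trans (regroup ((- 1ℚ) ^ℚ t) (ℕ→ℚ 2 ^ℚ (t ℕ.* 2))) (cong (- ℕ→ℚ 4 *_) ([-1]^t*2^[t*2]≡[-4]^t t))
  where
  regroup : ∀ x y → (- 1ℚ * x) * (ℕ→ℚ 2 * (ℕ→ℚ 2 * y)) ≡ - ℕ→ℚ 4 * (x * y)
  regroup = solve-∀ ℚ-ring

¬2∣r+t*4 : ∀ r t → ¬ 2 ∣ r → ¬ 2 ∣ r ℕ.+ t ℕ.* 4
¬2∣r+t*4 r t 2∤r 2∣r+4t =
  2∤r (∣m+n∣m⇒∣n (subst (2 ∣_) (ℕ.+-comm r (t ℕ.* 4)) 2∣r+4t) (∣-trans (divides 2 refl) (n∣m*n t)))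

g-pred-[4+4t] : ∀ t →
  g (3 ℕ.+ t ℕ.* 4) ≡ ½ * ((- 1ℚ) ^ℚ (suc t ℕ.* 4 ℕ./ 4) * ℕ→ℚ 2 ^ℚ (suc t ℕ.* 4 ℕ./ 2 ∸ 1) - 1ℚ)
g-pred-[4+4t] t = begin
  g (3 ℕ.+ t ℕ.* 4)
    ≡⟨ g-[3+4t] t ⟩
  ½ * (- ℕ→ℚ 2 * (- ℕ→ℚ 4) ^ℚ t - 1ℚ)
    ≡⟨ cong (λ x → ½ * (- ℕ→ℚ 2 * x - 1ℚ)) (sym ([-1]^t*2^[t*2]≡[-4]^t t)) ⟩
  ½ * (- ℕ→ℚ 2 * ((- 1ℚ) ^ℚ t * ℕ→ℚ 2 ^ℚ (t ℕ.* 2)) - 1ℚ)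
    ≡⟨ cong (λ x → ½ * (x - 1ℚ)) (regroup ((- 1ℚ) ^ℚ t) (ℕ→ℚ 2 ^ℚ (t ℕ.* 2))) ⟩
  ½ * ((- 1ℚ) ^ℚ suc t * ℕ→ℚ 2 ^ℚ suc (t ℕ.* 2) - 1ℚ)
    ≡⟨ cong₂ (λ q h → ½ * ((- 1ℚ) ^ℚ q * ℕ→ℚ 2 ^ℚ h - 1ℚ)) (sym (m*n/n≡m (suc t) 4)) (sym half) ⟩
  ½ * ((- 1ℚ) ^ℚ (suc t ℕ.* 4 ℕ./ 4) * ℕ→ℚ 2 ^ℚ (suc t ℕ.* 4 ℕ./ 2 ∸ 1) - 1ℚ) ∎
  where
  open ≡-Reasoning
  regroup : ∀ x y → - ℕ→ℚ 2 * (x * y) ≡ (- 1ℚ * x) * (ℕ→ℚ 2 * y)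
  regroup = solve-∀ ℚ-ring
  4+4t≡[2+2t]*2 : ∀ t → suc t ℕ.* 4 ≡ (2 ℕ.+ t ℕ.* 2) ℕ.* 2
  4+4t≡[2+2t]*2 = ℕ-solve-∀
  half : suc t ℕ.* 4 ℕ./ 2 ∸ 1 ≡ suc (t ℕ.* 2)
  half = cong (_∸ 1) (trans (cong (ℕ._/ 2) (4+4t≡[2+2t]*2 t)) (m*n/n≡m (2 ℕ.+ t ℕ.* 2) 2))

g-pred-[2+4t] : ∀ t →
  g (1 ℕ.+ t ℕ.* 4) ≡ ½ * ((- 1ℚ) ^ℚ ((2 ℕ.+ t ℕ.* 4) ℕ./ 4) * ℕ→ℚ 2 ^ℚ ((2 ℕ.+ t ℕ.* 4) ℕ./ 2 ∸ 1) - 1ℚ)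
g-pred-[2+4t] t = begin
  g (1 ℕ.+ t ℕ.* 4)
    ≡⟨ g-[1+4t] t ⟩
  ½ * ((- ℕ→ℚ 4) ^ℚ t - 1ℚ)
    ≡⟨ cong (λ x → ½ * (x - 1ℚ)) (sym ([-1]^t*2^[t*2]≡[-4]^t t)) ⟩
  ½ * ((- 1ℚ) ^ℚ t * ℕ→ℚ 2 ^ℚ (t ℕ.* 2) - 1ℚ)
    ≡⟨ cong₂ (λ q h → ½ * ((- 1ℚ) ^ℚ q * ℕ→ℚ 2 ^ℚ h - 1ℚ)) (sym quarter) (sym half) ⟩
  ½ * ((- 1ℚ) ^ℚ ((2 ℕ.+ t ℕ.* 4) ℕ./ 4) * ℕ→ℚ 2 ^ℚ ((2 ℕ.+ t ℕ.* 4) ℕ./ 2 ∸ 1) - 1ℚ) ∎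
  where
  open ≡-Reasoning
  2+4t≡[1+2t]*2 : ∀ t → 2 ℕ.+ t ℕ.* 4 ≡ (1 ℕ.+ t ℕ.* 2) ℕ.* 2
  2+4t≡[1+2t]*2 = ℕ-solve-∀
  quarter : (2 ℕ.+ t ℕ.* 4) ℕ./ 4 ≡ t
  quarter = trans (+-distrib-/-∣ʳ 2 {d = 4} (n∣m*n t)) (m*n/n≡m t 4)
  half : (2 ℕ.+ t ℕ.* 4) ℕ./ 2 ∸ 1 ≡ t ℕ.* 2
  half = cong (_∸ 1) (trans (cong (ℕ._/ 2) (2+4t≡[1+2t]*2 t)) (m*n/n≡m (1 ℕ.+ t ℕ.* 2) 2))

g-pred-even : ∀ n → 2 ∣ n → 2 ℕ.≤ n →
  g (n ∸ 1) ≡ ½ * ((- 1ℚ) ^ℚ (n ℕ./ 4) * ℕ→ℚ 2 ^ℚ (n ℕ./ 2 ∸ 1) - 1ℚ)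
g-pred-even = mod-4-elim
  (λ n → 2 ∣ n → 2 ℕ.≤ n → g (n ∸ 1) ≡ ½ * ((- 1ℚ) ^ℚ (n ℕ./ 4) * ℕ→ℚ 2 ^ℚ (n ℕ./ 2 ∸ 1) - 1ℚ))
  (λ { zero _ () ; (suc t) _ _ → g-pred-[4+4t] t })
  (λ t 2∣1+4t _ → ⊥-elim (¬2∣r+t*4 1 t (from-no (2 ∣? 1)) 2∣1+4t))
  (λ t _ _ → g-pred-[2+4t] t)
  (λ t 2∣3+4t _ → ⊥-elim (¬2∣r+t*4 3 t (from-no (2 ∣? 3)) 2∣3+4t))

corollary2p8 : (B : ℕ → ℚ) → IsBernoulli B →
    (n : ℕ) → 2 ∣ n → 2 ℕ.≤ n →
    sumDiv 1 n 4 (λ k → ℕ→ℚ (n C k) * ((((- (ℕ→ℚ 4)) ^ℚ (k ℕ./ 4)) - ℕ→ℚ 2) * B (n ∸ k)))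
      ≡ ((ℤ.+ n) / 2) * ((((- 1ℚ) ^ℚ (n ℕ./ 4)) * (ℕ→ℚ 2 ^ℚ ((n ℕ./ 2) ∸ 1))) - 1ℚ)
corollary2p8 B isBernoulli zero    _   ()
corollary2p8 B isBernoulli (suc n) 2∣n 2≤n = begin
  sumDiv 1 (suc n) 4 (λ k → ℕ→ℚ (suc n C k) * (((- ℕ→ℚ 4) ^ℚ (k ℕ./ 4) - ℕ→ℚ 2) * B (suc n ∸ k)))
    ≡⟨ sumDiv≡Σ<-binomialSum< B (suc n) ⟩
  Σ< (suc (suc n)) (λ k → ℕ→ℚ (suc n C k) * (binomialSum< g k * B (suc n ∸ k)))
    ≡⟨ bernoulli-inversion isBernoulli g n ⟩
  ℕ→ℚ (suc n) * g n
    ≡⟨ cong (ℕ→ℚ (suc n) *_) (g-pred-even (suc n) 2∣n 2≤n) ⟩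
  ℕ→ℚ (suc n) * (½ * X)
    ≡⟨ sym (*-assoc (ℕ→ℚ (suc n)) ½ X) ⟩
  ℕ→ℚ (suc n) * ½ * X
    ≡⟨ cong (_* X) (sym (+n/2≡ℕ→ℚn*½ (suc n))) ⟩
  ℤ.+ suc n / 2 * X ∎
  where
  open ≡-Reasoning
  X : ℚ
  X = (- 1ℚ) ^ℚ (suc n ℕ./ 4) * ℕ→ℚ 2 ^ℚ (suc n ℕ./ 2 ∸ 1) - 1ℚ
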